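{- Let $a,b,x\ge 0$ be integers and $p\in[0,1]$, $q=1-p$. Two walkers $U$ and $L$ start at $(a,b+x+1)$ and $(a+x+1,b)$ respectively and move independently: from a point $(r,s)$ with $r,s>0$ a walker steps West to $(r-1,s)$ with probability $p$ and South to $(r,s-1)$ with probability $q$; once a walker is on the $x$-axis it moves West along the axis (and once on the $y$-axis it moves South along the axis) until reaching the origin. If $B(a,b,x)$ denotes the probability that the first time the two walkers meet (occupy a common lattice point at the same time) is at the origin, then $$B(a,b,x)=\sum_{t=0}^{x}\binom{a+b+x}{a+t}p^{a+t}q^{b+x-t}.$$
   Formalization: The probability p ranges over the rationals in $[0,1]$ rather than over all real values in that interval. -}

module Defs where

open import Data.Bool using (Bool; true; false; if_then_else_; _∧_)
open import Data.Nat as ℕ using (ℕ; zero; suc; _≡ᵇ_)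
open import Data.Nat.Combinatorics using (_C_)
open import Data.Integer using (+_)
open import Data.Rational using (ℚ; 0ℚ; 1ℚ; _+_; _*_; _-_; _/_)
open import Data.Product using (_×_; _,_; proj₁; proj₂)
open import Data.List using (List; []; _∷_; map; _++_; foldr; upTo)

ℕ→ℚ : ℕ → ℚ
ℕ→ℚ n = + n / 1

_^_ : ℚ → ℕ → ℚ
r ^ zero  = 1ℚ
r ^ suc n = r * (r ^ n)

infixr 8 _^_

sumℚ : List ℚ → ℚ
sumℚ = foldr _+_ 0ℚ

Point : Set
Point = ℕ × ℕ

_==_ : Point → Point → Bool
(r , s) == (r' , s') = (r ≡ᵇ r') ∧ (s ≡ᵇ s')

origin : Point
origin = (0 , 0)

-- A trajectory is the list of positions visited at times 0,1,2,...
-- until (and including) the origin.  walks p r s lists every possible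
-- trajectory of a walker started at (r , s) together with its
-- probability: from (r,s) with r,s>0 step West w.p. p, South w.p. q=1-p;
-- on the x-axis step West (w.p. 1), on the y-axis step South (w.p. 1).
Walk : Set
Walk = List Point × ℚ

prepend : Point → ℚ → Walk → Walk
prepend pt c (tr , w) = (pt ∷ tr , c * w)

walks : ℚ → ℕ → ℕ → List Walk
walks p zero    zero    = ((origin ∷ []) , 1ℚ) ∷ []
walks p (suc r) zero    = map (prepend (suc r , zero) 1ℚ) (walks p r zero)
walks p zero    (suc s) = map (prepend (zero , suc s) 1ℚ) (walks p zero s)
walks p (suc r) (suc s) =
  map (prepend (suc r , suc s) p) (walks p r (suc s))
  ++ map (prepend (suc r , suc s) (1ℚ - p)) (walks p (suc r) s)

firstMeetAtOrigin : List Point → List Point → Bool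
firstMeetAtOrigin (u ∷ us) (l ∷ ls) =
  if u == l then u == origin else firstMeetAtOrigin us ls
firstMeetAtOrigin _ _ = false

indicator : Bool → ℚ
indicator true  = 1ℚ
indicator false = 0ℚ

-- B(a,b,x): probability (walkers independent, so pair probabilities
-- multiply) that U from (a, b+x+1) and L from (a+x+1, b) first meet at
-- the origin.
B : ℚ → ℕ → ℕ → ℕ → ℚ
B p a b x =
  sumℚ (map (λ U →
    sumℚ (map (λ L →
      proj₂ U * proj₂ L * indicator (firstMeetAtOrigin (proj₁ U) (proj₁ L)))
      (walks p (a ℕ.+ x ℕ.+ 1) b)))
    (walks p a (b ℕ.+ x ℕ.+ 1)))

RHS : ℚ → ℕ → ℕ → ℕ → ℚ
RHS p a b x =
  sumℚ (map (λ t → ℕ→ℚ ((a ℕ.+ b ℕ.+ x) C (a ℕ.+ t))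
                   * p ^ (a ℕ.+ t) * (1ℚ - p) ^ (b ℕ.+ x ℕ.∸ t))
            (upTo (suc x)))

module Submission where

-- Both walkers always lie on a common anti-diagonal, so a state is a triple
-- (a, b, g): U at (a, b + g) and L at (a + g, b), at gap g. Conditioning on the
-- first pair of steps writes the probability of first meeting at the origin in
-- terms of states one anti-diagonal lower; together with its values at gap 0
-- this recursion determines the probability. The binomial window
-- P(a ≤ Bin(a + b + g - 1, p) < a + g) satisfies the same recursion by Pascal's
-- rule, and at gap x + 1 it is the right-hand side.

open import Defs
open import Algebra.Bundles using (Ring)
open import Data.Bool using (true; false; _∧_)
open import Data.Bool.Properties using (∧-zeroʳ)
open import Data.Fin using (toℕ)
open import Data.Fin.Properties using (toℕ-inject₁; toℕ-fromℕ)
open import Data.Integer as ℤ using ()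
open import Data.Integer.Properties as ℤ using (pos-+)
open import Data.List using (List; []; _∷_; map; _++_; applyUpTo)
open import Data.List.Properties using (map-∘; map-++)
open import Data.Nat as ℕ using (ℕ; zero; suc; _∸_; _≡ᵇ_; s≤s; z≤n)
open import Data.Nat.Combinatorics using (_C_; nCk+nC[k+1]≡[n+1]C[k+1])
open import Data.Nat.Combinatorics.Specification using (k>n⇒nCk≡0)
open import Data.Nat.Coprimality as Coprimality using (1-coprimeTo)
open import Data.Nat.Properties as ℕ using (+-suc; [m+n]∸[m+o]≡n∸o; m<n⇒m<1+n; n<1+n; ≤-reflexive)
open import Data.Product using (_,_; proj₁; proj₂)
open import Data.Rational
  using (ℚ; 0ℚ; 1ℚ; _+_; _*_; _-_; _≤_; _≟_)
open import Data.Vec.Functional using (Vector)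
open import Data.Rational.Properties as ℚ
  using (normalize-coprime; /-cong; *-zeroˡ; *-zeroʳ; *-identityˡ; *-identityʳ; *-distribˡ-+;
         +-identityˡ; +-identityʳ; +-*-ring; +-*-commutativeRing)
open import Function using (_∘_; id)
open import Level using (0ℓ)
open import Relation.Binary.PropositionalEquality
open import Relation.Nullary.Decidable using (dec⇒maybe)
open import Tactic.RingSolver using (solve-∀)
open import Tactic.RingSolver.Core.AlmostCommutativeRing
  using (AlmostCommutativeRing; fromCommutativeRing)

open import Algebra.Properties.Semiring.Sum (Ring.semiring +-*-ring)
  using (sum-syntax; sum-cong-≗; sum-init-last; ∑-distrib-+; *-distribˡ-sum)

open ≡-Reasoning

ℚ-ring : AlmostCommutativeRing 0ℓ 0ℓ
ℚ-ring = fromCommutativeRing +-*-commutativeRing (dec⇒maybe ∘ (0ℚ ≟_))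

≡ᵇ-refl : ∀ n → (n ≡ᵇ n) ≡ true
≡ᵇ-refl zero    = refl
≡ᵇ-refl (suc n) = ≡ᵇ-refl n

m≡ᵇm+[1+n]≡false : ∀ m n → (m ≡ᵇ m ℕ.+ suc n) ≡ false
m≡ᵇm+[1+n]≡false zero    n = refl
m≡ᵇm+[1+n]≡false (suc m) n = m≡ᵇm+[1+n]≡false m n

==-refl : ∀ u → (u == u) ≡ true
==-refl (r , s) rewrite ≡ᵇ-refl r | ≡ᵇ-refl s = refl

ℕ→ℚ-homo-+ : ∀ m n → ℕ→ℚ (m ℕ.+ n) ≡ ℕ→ℚ m + ℕ→ℚ n
ℕ→ℚ-homo-+ m n
  rewrite normalize-coprime (Coprimality.sym (1-coprimeTo m))
        | normalize-coprime (Coprimality.sym (1-coprimeTo n)) =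
  /-cong (trans (pos-+ m n) (sym (cong₂ ℤ._+_ (ℤ.*-identityʳ (ℤ.+ m)) (ℤ.*-identityʳ (ℤ.+ n))))) refl

sumℚ-++ : ∀ xs ys → sumℚ (xs ++ ys) ≡ sumℚ xs + sumℚ ys
sumℚ-++ []       ys = sym (+-identityˡ _)
sumℚ-++ (x ∷ xs) ys = trans (cong (x +_) (sumℚ-++ xs ys)) (sym (ℚ.+-assoc x _ _))

sumℚ-map-scale : ∀ {A : Set} {f g : A → ℚ} c → (∀ x → f x ≡ c * g x) →
                 ∀ xs → sumℚ (map f xs) ≡ c * sumℚ (map g xs)
sumℚ-map-scale c f≡cg []       = sym (*-zeroʳ c)
sumℚ-map-scale c f≡cg (x ∷ xs) =
  trans (cong₂ _+_ (f≡cg x) (sumℚ-map-scale c f≡cg xs)) (sym (*-distribˡ-+ c _ _))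

sumℚ-map-applyUpTo : ∀ (f : ℕ → ℚ) (h : ℕ → ℕ) n →
                     sumℚ (map f (applyUpTo h n)) ≡ ∑[ i < n ] f (h (toℕ i))
sumℚ-map-applyUpTo f h zero    = refl
sumℚ-map-applyUpTo f h (suc n) = cong (f (h 0) +_) (sumℚ-map-applyUpTo f (h ∘ suc) n)

module Binomial (p q : ℚ) where

  binomial : ℕ → ℕ → ℚ
  binomial zero    zero    = 1ℚ
  binomial zero    (suc k) = 0ℚ
  binomial (suc n) zero    = q * binomial n zero
  binomial (suc n) (suc k) = p * binomial n k + q * binomial n (suc k)

  n<k⇒binomial≡0 : ∀ {n k} → n ℕ.< k → binomial n k ≡ 0ℚ
  n<k⇒binomial≡0 {zero}  {suc k} _         = refl
  n<k⇒binomial≡0 {suc n} {suc k} (s≤s n<k) =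
    trans (cong₂ (λ x y → p * x + q * y) (n<k⇒binomial≡0 n<k) (n<k⇒binomial≡0 (m<n⇒m<1+n n<k)))
          (cong₂ _+_ (*-zeroʳ p) (*-zeroʳ q))

  -- For n ≤ k truncated subtraction makes both exponents 0, whence the hypothesis on c.
  c*q^[n∸k]≡q*c*q^[n∸1+k] : ∀ n k c → (n ℕ.≤ k → c ≡ 0ℚ) →
                             c * q ^ (n ∸ k) ≡ q * (c * q ^ (n ∸ suc k))
  c*q^[n∸k]≡q*c*q^[n∸1+k] zero    k       c c≡0 with c≡0 z≤n
  ... | refl = trans (*-zeroˡ (q ^ (0 ∸ k))) (sym (*-zeroʳ q))
  c*q^[n∸k]≡q*c*q^[n∸1+k] (suc n) zero    c _   = x*[y*z]≡y*[x*z] c q (q ^ n)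
    where
    x*[y*z]≡y*[x*z] : ∀ x y z → x * (y * z) ≡ y * (x * z)
    x*[y*z]≡y*[x*z] = solve-∀ ℚ-ring
  c*q^[n∸k]≡q*c*q^[n∸1+k] (suc n) (suc k) c c≡0 = c*q^[n∸k]≡q*c*q^[n∸1+k] n k c (c≡0 ∘ s≤s)

  binomial-closedForm : ∀ n k → ℕ→ℚ (n C k) * p ^ k * q ^ (n ∸ k) ≡ binomial n k
  binomial-closedForm zero    zero    = refl
  binomial-closedForm zero    (suc k) = cong (_* 1ℚ) (*-zeroˡ (p ^ suc k))
  binomial-closedForm (suc n) zero    =
    trans (*-identityˡ _) (cong (q *_) (trans (sym (*-identityˡ _)) (binomial-closedForm n zero)))
  binomial-closedForm (suc n) (suc k) = begin
    ℕ→ℚ (suc n C suc k) * (p * pᵏ) * q ^ (n ∸ k)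
      ≡⟨ cong (λ c → c * (p * pᵏ) * q ^ (n ∸ k)) pascal ⟩
    (A + A′) * (p * pᵏ) * q ^ (n ∸ k)
      ≡⟨ split-left A A′ p pᵏ (q ^ (n ∸ k)) ⟩
    p * (A * pᵏ * q ^ (n ∸ k)) + p * pᵏ * (A′ * q ^ (n ∸ k))
      ≡⟨ cong (λ y → p * (A * pᵏ * q ^ (n ∸ k)) + p * pᵏ * y)
              (c*q^[n∸k]≡q*c*q^[n∸1+k] n k A′ (λ n≤k → cong ℕ→ℚ (k>n⇒nCk≡0 (s≤s n≤k)))) ⟩
    p * (A * pᵏ * q ^ (n ∸ k)) + p * pᵏ * (q * (A′ * q ^ (n ∸ suc k)))
      ≡⟨ cong (p * (A * pᵏ * q ^ (n ∸ k)) +_) (shuffle p pᵏ q A′ (q ^ (n ∸ suc k))) ⟩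
    p * (A * pᵏ * q ^ (n ∸ k)) + q * (A′ * (p * pᵏ) * q ^ (n ∸ suc k))
      ≡⟨ cong₂ (λ x y → p * x + q * y) (binomial-closedForm n k) (binomial-closedForm n (suc k)) ⟩
    p * binomial n k + q * binomial n (suc k) ∎
    where
    pᵏ A A′ : ℚ
    pᵏ = p ^ k
    A  = ℕ→ℚ (n C k)
    A′ = ℕ→ℚ (n C suc k)
    pascal : ℕ→ℚ (suc n C suc k) ≡ A + A′
    pascal = trans (cong ℕ→ℚ (sym (nCk+nC[k+1]≡[n+1]C[k+1] n k))) (ℕ→ℚ-homo-+ (n C k) (n C suc k))
    split-left : ∀ a a′ x y z → (a + a′) * (x * y) * z ≡ x * (a * y * z) + x * y * (a′ * z)
    split-left = solve-∀ ℚ-ring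
    shuffle : ∀ x y z a w → x * y * (z * (a * w)) ≡ z * (a * (x * y) * w)
    shuffle = solve-∀ ℚ-ring

  window : ℕ → ℕ → ℕ → ℚ
  window n k m = ∑[ i < m ] binomial n (k ℕ.+ toℕ i)

  window-snoc : ∀ n k m → window n k (suc m) ≡ window n k m + binomial n (k ℕ.+ m)
  window-snoc n k m = trans (sum-init-last {m} (λ i → binomial n (k ℕ.+ toℕ i)))
    (cong₂ _+_ (sum-cong-≗ {m} (λ i → cong (binomial n ∘ (k ℕ.+_)) (toℕ-inject₁ i)))
               (cong (binomial n ∘ (k ℕ.+_)) (toℕ-fromℕ m)))

  window-beyond : ∀ {n k m} → n ℕ.< k ℕ.+ m → window n k (suc m) ≡ window n k m
  window-beyond {n} {k} {m} n<k+m = begin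
    window n k (suc m)                ≡⟨ window-snoc n k m ⟩
    window n k m + binomial n (k ℕ.+ m) ≡⟨ cong (window n k m +_) (n<k⇒binomial≡0 n<k+m) ⟩
    window n k m + 0ℚ                 ≡⟨ +-identityʳ (window n k m) ⟩
    window n k m                      ∎

  window-step : ∀ n k m → window (suc n) (suc k) m ≡ p * window n k m + q * window n (suc k) m
  window-step n k m = trans (∑-distrib-+ (λ i → p * b k i) (λ i → q * b (suc k) i))
    (cong₂ _+_ (sym (*-distribˡ-sum p (b k))) (sym (*-distribˡ-sum q (b (suc k)))))
    where
    b : ℕ → Vector ℚ m
    b j i = binomial n (j ℕ.+ toℕ i)

  window-step₀ : ∀ n m → window (suc n) 0 (suc m) ≡ p * window n 0 m + q * window n 0 (suc m)
  window-step₀ n m = trans (cong (q * binomial n 0 +_) (window-step n 0 m))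
                           (regroup q p (binomial n 0) (window n 0 m) (window n 1 m))
    where
    regroup : ∀ x y b u v → x * b + (y * u + x * v) ≡ y * u + x * (b + v)
    regroup = solve-∀ ℚ-ring

record MeetingRecurrence (p q : ℚ) (F : ℕ → ℕ → ℕ → ℚ) : Set where
  field
    gap-zero    : ∀ a b → F a b 0 ≡ indicator ((a , b) == origin)
    origin-axes : ∀ g → F 0 0 (suc g) ≡ F 0 0 g
    y-axis      : ∀ b g → F 0 (suc b) (suc g) ≡ p * F 0 (suc b) g + q * F 0 b (suc g)
    x-axis      : ∀ a g → F (suc a) 0 (suc g) ≡ p * F a 0 (suc g) + q * F (suc a) 0 g
    interior    : ∀ a b g → F (suc a) (suc b) (suc g)
                    ≡ (p * p * F a (suc b) (suc g) + p * q * F a b (suc (suc g)))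
                      + (q * p * F (suc a) (suc b) g + q * q * F (suc a) b (suc g))

module _ {p q : ℚ} {F G : ℕ → ℕ → ℕ → ℚ} (RF : MeetingRecurrence p q F) (RG : MeetingRecurrence p q G) where
  open MeetingRecurrence

  meetingRecurrence-unique : ∀ a b g → F a b g ≡ G a b g
  meetingRecurrence-unique a b zero = trans (gap-zero RF a b) (sym (gap-zero RG a b))
  meetingRecurrence-unique zero zero (suc g) =
    trans (origin-axes RF g) (trans (meetingRecurrence-unique 0 0 g) (sym (origin-axes RG g)))
  meetingRecurrence-unique zero (suc b) (suc g) = begin
    F 0 (suc b) (suc g)                        ≡⟨ y-axis RF b g ⟩
    p * F 0 (suc b) g + q * F 0 b (suc g)      ≡⟨ cong₂ (λ x y → p * x + q * y) (meetingRecurrence-unique 0 (suc b) g)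
                                                                          (meetingRecurrence-unique 0 b (suc g)) ⟩
    p * G 0 (suc b) g + q * G 0 b (suc g)      ≡⟨ y-axis RG b g ⟨
    G 0 (suc b) (suc g)                        ∎
  meetingRecurrence-unique (suc a) zero (suc g) = begin
    F (suc a) 0 (suc g)                        ≡⟨ x-axis RF a g ⟩
    p * F a 0 (suc g) + q * F (suc a) 0 g      ≡⟨ cong₂ (λ x y → p * x + q * y) (meetingRecurrence-unique a 0 (suc g))
                                                                          (meetingRecurrence-unique (suc a) 0 g) ⟩
    p * G a 0 (suc g) + q * G (suc a) 0 g      ≡⟨ x-axis RG a g ⟨
    G (suc a) 0 (suc g)                        ∎
  meetingRecurrence-unique (suc a) (suc b) (suc g) =
    trans (interior RF a b g)
      (trans (cong₂ _+_ (cong₂ (λ x y → p * p * x + p * q * y) (meetingRecurrence-unique a (suc b) (suc g))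
                                                               (meetingRecurrence-unique a b (suc (suc g))))
                        (cong₂ (λ x y → q * p * x + q * q * y) (meetingRecurrence-unique (suc a) (suc b) g)
                                                               (meetingRecurrence-unique (suc a) b (suc g))))
             (sym (interior RG a b g)))

pairWeight : Walk → Walk → ℚ
pairWeight U L = proj₂ U * proj₂ L * indicator (firstMeetAtOrigin (proj₁ U) (proj₁ L))

pairWeightSum : List Walk → Walk → ℚ
pairWeightSum Ls U = sumℚ (map (pairWeight U) Ls)

originMeetProb : List Walk → List Walk → ℚ
originMeetProb Us Ls = sumℚ (map (pairWeightSum Ls) Us)

originMeetProb-++ˡ : ∀ Us Us′ Ls → originMeetProb (Us ++ Us′) Ls ≡ originMeetProb Us Ls + originMeetProb Us′ Ls
originMeetProb-++ˡ Us Us′ Ls = trans (cong sumℚ (map-++ (pairWeightSum Ls) Us Us′))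
        (sumℚ-++ (map (pairWeightSum Ls) Us) (map (pairWeightSum Ls) Us′))

originMeetProb-++ʳ : ∀ Us Ls Ls′ → originMeetProb Us (Ls ++ Ls′) ≡ originMeetProb Us Ls + originMeetProb Us Ls′
originMeetProb-++ʳ []       Ls Ls′ = sym (+-identityʳ 0ℚ)
originMeetProb-++ʳ (U ∷ Us) Ls Ls′ =
  trans (cong₂ _+_ row (originMeetProb-++ʳ Us Ls Ls′))
        (interchange (pairWeightSum Ls U) (pairWeightSum Ls′ U) (originMeetProb Us Ls) (originMeetProb Us Ls′))
  where
  row : pairWeightSum (Ls ++ Ls′) U ≡ pairWeightSum Ls U + pairWeightSum Ls′ U
  row = trans (cong sumℚ (map-++ (pairWeight U) Ls Ls′)) (sumℚ-++ (map (pairWeight U) Ls) (map (pairWeight U) Ls′))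
  interchange : ∀ w x y z → (w + x) + (y + z) ≡ (w + y) + (x + z)
  interchange = solve-∀ ℚ-ring

originMeetProb-split : ∀ Us Us′ Ls Ls′ → originMeetProb (Us ++ Us′) (Ls ++ Ls′)
  ≡ (originMeetProb Us Ls + originMeetProb Us Ls′) + (originMeetProb Us′ Ls + originMeetProb Us′ Ls′)
originMeetProb-split Us Us′ Ls Ls′ =
  trans (originMeetProb-++ˡ Us Us′ (Ls ++ Ls′)) (cong₂ _+_ (originMeetProb-++ʳ Us Ls Ls′) (originMeetProb-++ʳ Us′ Ls Ls′))

originMeetProb-map : ∀ k (f g : Walk → Walk) → (∀ U L → pairWeight (f U) (g L) ≡ k * pairWeight U L) →
                     ∀ Us Ls → originMeetProb (map f Us) (map g Ls) ≡ k * originMeetProb Us Ls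
originMeetProb-map k f g scaled Us Ls =
  trans (cong sumℚ (sym (map-∘ Us))) (sumℚ-map-scale k row Us)
  where
  row : ∀ U → pairWeightSum (map g Ls) (f U) ≡ k * pairWeightSum Ls U
  row U = trans (cong sumℚ (sym (map-∘ Ls))) (sumℚ-map-scale k (scaled U) Ls)

module _ {u : Point} (c d : ℚ) where

  pairWeight-prepend-apart : ∀ {l} → (u == l) ≡ false →
    ∀ U L → pairWeight (prepend u c U) (prepend l d L) ≡ c * d * pairWeight U L
  pairWeight-prepend-apart u≠l U L rewrite u≠l =
    rearrange c d (proj₂ U) (proj₂ L) (indicator (firstMeetAtOrigin (proj₁ U) (proj₁ L)))
    where
    rearrange : ∀ c d w v i → c * w * (d * v) * i ≡ c * d * (w * v * i)
    rearrange = solve-∀ ℚ-ring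

  pairWeight-prepend-meet : (u == origin) ≡ false →
    ∀ U L → pairWeight (prepend u c U) (prepend u d L) ≡ 0ℚ * pairWeight U L
  pairWeight-prepend-meet u≠origin U L rewrite ==-refl u | u≠origin =
    trans (*-zeroʳ (c * proj₂ U * (d * proj₂ L))) (sym (*-zeroˡ (pairWeight U L)))

  originMeetProb-prepend-apart : ∀ {l} → (u == l) ≡ false →
    ∀ Us Ls → originMeetProb (map (prepend u c) Us) (map (prepend l d) Ls) ≡ c * d * originMeetProb Us Ls
  originMeetProb-prepend-apart u≠l = originMeetProb-map (c * d) _ _ (pairWeight-prepend-apart u≠l)

  originMeetProb-prepend-meet : (u == origin) ≡ false →
    ∀ Us Ls → originMeetProb (map (prepend u c) Us) (map (prepend u d) Ls) ≡ 0ℚ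
  originMeetProb-prepend-meet u≠origin Us Ls =
    trans (originMeetProb-map 0ℚ _ _ (pairWeight-prepend-meet u≠origin) Us Ls) (*-zeroˡ (originMeetProb Us Ls))

module FirstMeeting (p : ℚ) where

  originMeetProb-walks-diagonal : ∀ r s → originMeetProb (walks p r s) (walks p r s) ≡ indicator ((r , s) == origin)
  originMeetProb-walks-diagonal zero    zero    = refl
  originMeetProb-walks-diagonal (suc r) zero    =
    originMeetProb-prepend-meet 1ℚ 1ℚ refl (walks p r zero) (walks p r zero)
  originMeetProb-walks-diagonal zero    (suc s) =
    originMeetProb-prepend-meet 1ℚ 1ℚ refl (walks p zero s) (walks p zero s)
  originMeetProb-walks-diagonal (suc r) (suc s) =
    trans (originMeetProb-split (map (prepend u p) Ws) (map (prepend u (1ℚ - p)) Ss)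
                                (map (prepend u p) Ws) (map (prepend u (1ℚ - p)) Ss))
          (cong₂ _+_ (cong₂ _+_ (meet p p Ws Ws) (meet p (1ℚ - p) Ws Ss))
                     (cong₂ _+_ (meet (1ℚ - p) p Ss Ws) (meet (1ℚ - p) (1ℚ - p) Ss Ss)))
    where
    u : Point
    u = (suc r , suc s)
    Ws Ss : List Walk
    Ws = walks p r (suc s)
    Ss = walks p (suc r) s
    meet : ∀ c d Us Ls → originMeetProb (map (prepend u c) Us) (map (prepend u d) Ls) ≡ 0ℚ
    meet c d = originMeetProb-prepend-meet c d refl

  firstMeetProb : ℕ → ℕ → ℕ → ℚ
  firstMeetProb a b g = originMeetProb (walks p a (b ℕ.+ g)) (walks p (a ℕ.+ g) b)

  firstMeetProb-at : ∀ a b g {s r} → s ≡ b ℕ.+ g → r ≡ a ℕ.+ g →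
                     originMeetProb (walks p a s) (walks p r b) ≡ firstMeetProb a b g
  firstMeetProb-at a b g refl refl = refl

  firstMeetProb-step : ∀ {u l} c d {k} → (u == l) ≡ false → c * d ≡ k →
    ∀ a b g {s r} → s ≡ b ℕ.+ g → r ≡ a ℕ.+ g →
    originMeetProb (map (prepend u c) (walks p a s)) (map (prepend l d) (walks p r b)) ≡ k * firstMeetProb a b g
  firstMeetProb-step {u} {l} c d u≠l c*d≡k a b g {s} {r} s≡b+g r≡a+g =
    trans (originMeetProb-prepend-apart {u} c d {l} u≠l (walks p a s) (walks p r b))
          (cong₂ _*_ c*d≡k (firstMeetProb-at a b g s≡b+g r≡a+g))

  firstMeetProb-recurrence : MeetingRecurrence p (1ℚ - p) firstMeetProb
  firstMeetProb-recurrence = record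
    { gap-zero    = λ a b → trans (sym (firstMeetProb-at a b 0 (sym (ℕ.+-identityʳ b)) (sym (ℕ.+-identityʳ a))))
                                  (originMeetProb-walks-diagonal a b)
    ; origin-axes = λ g → trans (firstMeetProb-step {0 , suc g} {suc g , 0} 1ℚ 1ℚ refl refl 0 0 g refl refl)
                                 (*-identityˡ (firstMeetProb 0 0 g))
    ; y-axis      = firstMeetProb-y-axis
    ; x-axis      = firstMeetProb-x-axis
    ; interior    = firstMeetProb-interior
    }
    where
    firstMeetProb-y-axis : ∀ b g → firstMeetProb 0 (suc b) (suc g)
      ≡ p * firstMeetProb 0 (suc b) g + (1ℚ - p) * firstMeetProb 0 b (suc g)
    firstMeetProb-y-axis b g =
      trans (originMeetProb-++ʳ (map (prepend u 1ℚ) (walks p 0 (b ℕ.+ suc g)))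
                                (map (prepend l p) (walks p g (suc b)))
                                (map (prepend l (1ℚ - p)) (walks p (suc g) b)))
            (cong₂ _+_ (firstMeetProb-step {u} {l} 1ℚ p refl (*-identityˡ p) 0 (suc b) g (+-suc b g) refl)
                       (firstMeetProb-step {u} {l} 1ℚ (1ℚ - p) refl (*-identityˡ (1ℚ - p)) 0 b (suc g) refl refl))
      where
      u l : Point
      u = (0 , suc (b ℕ.+ suc g))
      l = (suc g , suc b)

    firstMeetProb-x-axis : ∀ a g → firstMeetProb (suc a) 0 (suc g)
      ≡ p * firstMeetProb a 0 (suc g) + (1ℚ - p) * firstMeetProb (suc a) 0 g
    firstMeetProb-x-axis a g =
      trans (originMeetProb-++ˡ (map (prepend u p) (walks p a (suc g)))
                                (map (prepend u (1ℚ - p)) (walks p (suc a) g))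
                                (map (prepend l 1ℚ) (walks p (a ℕ.+ suc g) 0)))
            (cong₂ _+_ (firstMeetProb-step {u} {l} p 1ℚ apart (*-identityʳ p) a 0 (suc g) refl refl)
                       (firstMeetProb-step {u} {l} (1ℚ - p) 1ℚ apart (*-identityʳ (1ℚ - p)) (suc a) 0 g refl (+-suc a g)))
      where
      u l : Point
      u = (suc a , suc g)
      l = (suc (a ℕ.+ suc g) , 0)
      apart : (u == l) ≡ false
      apart = ∧-zeroʳ (a ≡ᵇ a ℕ.+ suc g)

    firstMeetProb-interior : ∀ a b g → firstMeetProb (suc a) (suc b) (suc g)
      ≡ (p * p * firstMeetProb a (suc b) (suc g) + p * (1ℚ - p) * firstMeetProb a b (suc (suc g)))
        + ((1ℚ - p) * p * firstMeetProb (suc a) (suc b) g + (1ℚ - p) * (1ℚ - p) * firstMeetProb (suc a) b (suc g))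
    firstMeetProb-interior a b g =
      trans (originMeetProb-split (map (prepend u p) (walks p a (suc (b ℕ.+ suc g))))
                                  (map (prepend u (1ℚ - p)) (walks p (suc a) (b ℕ.+ suc g)))
                                  (map (prepend l p) (walks p (a ℕ.+ suc g) (suc b)))
                                  (map (prepend l (1ℚ - p)) (walks p (suc (a ℕ.+ suc g)) b)))
        (cong₂ _+_
          (cong₂ _+_ (step p p a (suc b) (suc g) refl refl)
                     (step p (1ℚ - p) a b (suc (suc g)) (sym (+-suc b (suc g))) (sym (+-suc a (suc g)))))
          (cong₂ _+_ (step (1ℚ - p) p (suc a) (suc b) g (+-suc b g) (+-suc a g))
                     (step (1ℚ - p) (1ℚ - p) (suc a) b (suc g) refl refl)))
      where
      u l : Point
      u = (suc a , suc (b ℕ.+ suc g))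
      l = (suc (a ℕ.+ suc g) , suc b)
      step : ∀ c d a′ b′ g′ {s r} → s ≡ b′ ℕ.+ g′ → r ≡ a′ ℕ.+ g′ →
             originMeetProb (map (prepend u c) (walks p a′ s)) (map (prepend l d) (walks p r b′))
             ≡ c * d * firstMeetProb a′ b′ g′
      step c d = firstMeetProb-step c d (cong (_∧ (b ℕ.+ suc g ≡ᵇ b)) (m≡ᵇm+[1+n]≡false a g)) refl

module BinomialWindow (p : ℚ) where
  open Binomial p (1ℚ - p)

  -- P(a ≤ Bin(a + b + g - 1, p) < a + g); at gap 0 the walkers have already met.
  binomialWindow : ℕ → ℕ → ℕ → ℚ
  binomialWindow a b zero    = indicator ((a , b) == origin)
  binomialWindow a b (suc g) = window (a ℕ.+ b ℕ.+ g) a (suc g)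

  binomialWindow-sucˡ : ∀ a b g → binomialWindow (suc a) b g ≡ window (a ℕ.+ b ℕ.+ g) (suc a) g
  binomialWindow-sucˡ a b zero    = refl
  binomialWindow-sucˡ a b (suc g) = cong (λ n → window n (suc a) (suc g)) (sym (+-suc (a ℕ.+ b) g))

  binomialWindow-sucʳ : ∀ a b g → binomialWindow a (suc b) g ≡ window (a ℕ.+ b ℕ.+ g) a g
  binomialWindow-sucʳ a b zero    = cong indicator (∧-zeroʳ (a ≡ᵇ 0))
  binomialWindow-sucʳ a b (suc g) =
    cong (λ n → window n a (suc g)) (trans (cong (ℕ._+ g) (+-suc a b)) (sym (+-suc (a ℕ.+ b) g)))

  binomialWindow-origin-axes : ∀ g → binomialWindow 0 0 (suc g) ≡ binomialWindow 0 0 g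
  binomialWindow-origin-axes zero    = refl
  binomialWindow-origin-axes (suc g) = begin
    window (suc g) 0 (suc (suc g))
      ≡⟨ window-step₀ g (suc g) ⟩
    p * X + (1ℚ - p) * window g 0 (suc (suc g))
      ≡⟨ cong (λ w → p * X + (1ℚ - p) * w) (window-beyond (n<1+n g)) ⟩
    p * X + (1ℚ - p) * X
      ≡⟨ p*x+[1-p]*x≡x p X ⟩
    X ∎
    where
    X : ℚ
    X = window g 0 (suc g)
    p*x+[1-p]*x≡x : ∀ p x → p * x + (1ℚ - p) * x ≡ x
    p*x+[1-p]*x≡x = solve-∀ ℚ-ring

  binomialWindow-interior : ∀ a b g → binomialWindow (suc a) (suc b) (suc g)
    ≡ (p * p * binomialWindow a (suc b) (suc g) + p * (1ℚ - p) * binomialWindow a b (suc (suc g)))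
      + ((1ℚ - p) * p * binomialWindow (suc a) (suc b) g + (1ℚ - p) * (1ℚ - p) * binomialWindow (suc a) b (suc g))
  binomialWindow-interior a b g = begin
    window (suc n) (suc a) (suc g)
      ≡⟨ window-step n a (suc g) ⟩
    p * X + (1ℚ - p) * window n (suc a) (suc g)
      ≡⟨ cong (λ w → p * X + (1ℚ - p) * w) (window-snoc n (suc a) g) ⟩
    p * X + (1ℚ - p) * (Y + d)
      ≡⟨ split p X Y d ⟩
    (p * p * X + p * (1ℚ - p) * (X + d)) + ((1ℚ - p) * p * Y + (1ℚ - p) * (1ℚ - p) * (Y + d))
      ≡⟨ cong₂ (λ x y → (p * p * X + p * (1ℚ - p) * x) + ((1ℚ - p) * p * Y + (1ℚ - p) * (1ℚ - p) * y))
               (sym binomialWindow-a-b-2+g) (sym binomialWindow-1+a-b-1+g) ⟩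
    (p * p * X + p * (1ℚ - p) * binomialWindow a b (suc (suc g)))
      + ((1ℚ - p) * p * Y + (1ℚ - p) * (1ℚ - p) * binomialWindow (suc a) b (suc g))
      ≡⟨ cong (λ y → (p * p * X + p * (1ℚ - p) * binomialWindow a b (suc (suc g)))
                     + ((1ℚ - p) * p * y + (1ℚ - p) * (1ℚ - p) * binomialWindow (suc a) b (suc g)))
              (sym (binomialWindow-sucˡ a (suc b) g)) ⟩
    (p * p * binomialWindow a (suc b) (suc g) + p * (1ℚ - p) * binomialWindow a b (suc (suc g)))
      + ((1ℚ - p) * p * binomialWindow (suc a) (suc b) g + (1ℚ - p) * (1ℚ - p) * binomialWindow (suc a) b (suc g)) ∎
    where
    n : ℕ
    n = a ℕ.+ suc b ℕ.+ g
    X Y d : ℚ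
    X = window n a (suc g)
    Y = window n (suc a) g
    d = binomial n (suc a ℕ.+ g)
    split : ∀ p x y d → p * x + (1ℚ - p) * (y + d)
      ≡ (p * p * x + p * (1ℚ - p) * (x + d)) + ((1ℚ - p) * p * y + (1ℚ - p) * (1ℚ - p) * (y + d))
    split = solve-∀ ℚ-ring
    binomialWindow-a-b-2+g : binomialWindow a b (suc (suc g)) ≡ X + d
    binomialWindow-a-b-2+g = begin
      window (a ℕ.+ b ℕ.+ suc g) a (suc (suc g)) ≡⟨ cong (λ m → window m a (suc (suc g)))
                                                      (trans (+-suc (a ℕ.+ b) g) (sym (cong (ℕ._+ g) (+-suc a b)))) ⟩
      window n a (suc (suc g))                   ≡⟨ window-snoc n a (suc g) ⟩
      X + binomial n (a ℕ.+ suc g)               ≡⟨ cong (λ k → X + binomial n k) (+-suc a g) ⟩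
      X + d                                      ∎
    binomialWindow-1+a-b-1+g : binomialWindow (suc a) b (suc g) ≡ Y + d
    binomialWindow-1+a-b-1+g = trans (cong (λ m → window m (suc a) (suc g)) (sym (cong (ℕ._+ g) (+-suc a b))))
                        (window-snoc n (suc a) g)

  binomialWindow-recurrence : MeetingRecurrence p (1ℚ - p) binomialWindow
  binomialWindow-recurrence = record
    { gap-zero    = λ a b → refl
    ; origin-axes = binomialWindow-origin-axes
    ; y-axis      = λ b g → trans (window-step₀ (b ℕ.+ g) g)
        (cong (λ w → p * w + (1ℚ - p) * window (b ℕ.+ g) 0 (suc g)) (sym (binomialWindow-sucʳ 0 b g)))
    ; x-axis      = λ a g → trans (window-step (a ℕ.+ 0 ℕ.+ g) a (suc g))
        (cong (λ w → p * window (a ℕ.+ 0 ℕ.+ g) a (suc g) + (1ℚ - p) * w)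
              (trans (window-beyond (s≤s (≤-reflexive (cong (ℕ._+ g) (ℕ.+-identityʳ a)))))
                     (sym (binomialWindow-sucˡ a 0 g))))
    ; interior    = binomialWindow-interior
    }

  RHS≡binomialWindow : ∀ a b x → RHS p a b x ≡ binomialWindow a b (suc x)
  RHS≡binomialWindow a b x =
    trans (sumℚ-map-applyUpTo term id (suc x)) (sum-cong-≗ {suc x} (λ i → term≡binomial (toℕ i)))
    where
    n : ℕ
    n = a ℕ.+ b ℕ.+ x
    term : ℕ → ℚ
    term t = ℕ→ℚ (n C (a ℕ.+ t)) * p ^ (a ℕ.+ t) * (1ℚ - p) ^ (b ℕ.+ x ∸ t)
    term≡binomial : ∀ t → term t ≡ binomial n (a ℕ.+ t)
    term≡binomial t = trans
      (cong (λ e → ℕ→ℚ (n C (a ℕ.+ t)) * p ^ (a ℕ.+ t) * (1ℚ - p) ^ e)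
            (sym (trans (cong (_∸ (a ℕ.+ t)) (ℕ.+-assoc a b x)) ([m+n]∸[m+o]≡n∸o a (b ℕ.+ x) t))))
      (binomial-closedForm n (a ℕ.+ t))

open FirstMeeting
open BinomialWindow

mainTheorem10 : (a b x : ℕ) (p : ℚ) → 0ℚ ≤ p → p ≤ 1ℚ → B p a b x ≡ RHS p a b x
mainTheorem10 a b x p _ _ = begin
  B p a b x                    ≡⟨ firstMeetProb-at p a b (suc x) (+1≡suc b) (+1≡suc a) ⟩
  firstMeetProb p a b (suc x)  ≡⟨ meetingRecurrence-unique (firstMeetProb-recurrence p)
                                                           (binomialWindow-recurrence p) a b (suc x) ⟩
  binomialWindow p a b (suc x) ≡⟨ RHS≡binomialWindow p a b x ⟨
  RHS p a b x                  ∎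
  where
  +1≡suc : ∀ m → m ℕ.+ x ℕ.+ 1 ≡ m ℕ.+ suc x
  +1≡suc m = trans (ℕ.+-comm (m ℕ.+ x) 1) (sym (+-suc m x))
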